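{- Let $G$ be an arbitrary finite graph. Then $G\models\phi$ if and only if $G$ contains a bouquet of cycles as a free induced subgraph, where \[\psi(x,z):=\exists u\,\exists v\,[u\neq v\wedge u\neq x\wedge v\neq x\wedge E(z,u)\wedge E(z,v)\wedge\forall w\,(E(w,z)\to w=u\vee w=v\vee w=x)],\] \[\phi:=\exists x\,\exists y\,[E(x,y)\wedge\forall z\,(z\neq x\wedge \mathrm{dist}(x,z)\le 2\to E(x,z)\wedge\psi(x,z))].\]
   Context: Graphs are simple and undirected, viewed as structures with an irreflexive symmetric edge relation $E$. $\mathrm{dist}(x,z)\le 2$ is the first-order formula expressing that $x$ and $z$ are at distance at most $2$ in the graph. For $k\ge 1$ and $n_1,\dots,n_k\ge 3$, the bouquet of cycles of type $(n_1,\dots,n_k)$ is the graph obtained by taking the disjoint union of $k$ cycles of lengths $n_1,\dots,n_k$ and adding an apex vertex adjacent to every vertex of these cycles. An induced subgraph $B$ of $G$ is free in $G$ if $G$ is the disjoint union of $B$ and some graph $C$ (with no edges between them). -}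

module Defs where

open import Data.Nat using (ℕ; zero; suc; _≤_)
open import Data.Fin using (Fin; toℕ)
open import Data.Bool using (Bool; true; false; T)
open import Data.Maybe using (Maybe; just; nothing)
open import Data.Product using (Σ; proj₁; ∃; ∃-syntax; _×_; _,_)
open import Data.Sum using (_⊎_)
open import Data.Empty using (⊥)
open import Data.Unit using (⊤)
open import Relation.Nullary using (¬_)
open import Relation.Binary.PropositionalEquality using (_≡_; _≢_)
open import Function.Bundles using (_⤖_; _⇔_; Bijection)

record Graph : Set where
  field
    n     : ℕ
    adj   : Fin n → Fin n → Bool
    irrefl : ∀ v → ¬ T (adj v v)
    sym    : ∀ u v → T (adj u v) → T (adj v u)

  V : Set
  V = Fin n

  E : V → V → Set
  E u v = T (adj u v)

open Graph public

Dist≤2 : (G : Graph) → V G → V G → Set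
Dist≤2 G x z = x ≡ z ⊎ E G x z ⊎ (∃[ w ] (E G x w × E G w z))

ψ : (G : Graph) → V G → V G → Set
ψ G x z = ∃[ u ] ∃[ v ] (u ≢ v × u ≢ x × v ≢ x × E G z u × E G z v ×
            (∀ w → E G w z → w ≡ u ⊎ w ≡ v ⊎ w ≡ x))

Phi : Graph → Set
Phi G = ∃[ x ] ∃[ y ] (E G x y ×
          (∀ z → z ≢ x → Dist≤2 G x z → E G x z × ψ G x z))

CycStep : (m : ℕ) → Fin m → Fin m → Set
CycStep m a b = suc (toℕ a) ≡ toℕ b ⊎ (suc (toℕ a) ≡ m × toℕ b ≡ 0)

CycAdj : (m : ℕ) → Fin m → Fin m → Set
CycAdj m a b = CycStep m a b ⊎ CycStep m b a

-- Bouquet of cycles of type (ns 0, …, ns (k-1)): vertices are the apex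
-- (nothing) and the cycle vertices just (i , a) with a : Fin (ns i).
BVert : (k : ℕ) → (Fin k → ℕ) → Set
BVert k ns = Maybe (Σ (Fin k) (λ i → Fin (ns i)))

BAdj : (k : ℕ) (ns : Fin k → ℕ) → BVert k ns → BVert k ns → Set
BAdj k ns nothing  nothing  = ⊥
BAdj k ns nothing  (just _) = ⊤
BAdj k ns (just _) nothing  = ⊤
BAdj k ns (just (i , a)) (just (j , b)) =
  Σ (i ≡ j) (λ { _≡_.refl → CycAdj (ns i) a b })

InS : (G : Graph) → (V G → Bool) → Set
InS G S = Σ (V G) (λ v → T (S v))

FreeBouquet : (G : Graph) (k : ℕ) (ns : Fin k → ℕ) → Set
FreeBouquet G k ns =
  Σ (V G → Bool) λ S →
  Σ (InS G S ⤖ BVert k ns) λ f →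
    (∀ (p q : InS G S) →
       (E G (proj₁ p) (proj₁ q) ⇔
        BAdj k ns (Bijection.to f p) (Bijection.to f q)))
    × (∀ u v → T (S u) → ¬ T (S v) → ¬ E G u v)

HasFreeBouquet : Graph → Set
HasFreeBouquet G =
  ∃[ k ] (1 ≤ k × Σ (Fin k → ℕ) λ ns → (∀ i → 3 ≤ ns i) × FreeBouquet G k ns)

{-# OPTIONS --safe #-}
-- If x witnesses φ, every vertex within distance two of x is x or a neighbour of x, so no edge
-- leaves the closed neighbourhood N[x], and by ψ each z ∈ N(x) has exactly two neighbours inside
-- N(x). A finite 2-regular graph is a disjoint union of cycles: the non-backtracking walk from a
-- vertex first repeats a vertex at its start, closing a cycle of length ≥ 3 that contains all
-- neighbours of its vertices; split it off and recurse. With x as apex, N[x] is a free bouquet.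
-- Conversely, the apex of a free bouquet and any cycle vertex witness φ: the vertices within
-- distance two of the apex are its cycle vertices, each adjacent exactly to the apex and to its
-- two cycle neighbours.
module Submission where

open import Defs hiding (sym)
open import Data.Bool using (Bool; T; _∧_; _∨_; not)
open import Data.Bool.Properties using (T-irrelevant; T-∧; T-∨)
open import Data.Empty using (⊥-elim)
open import Data.Fin as Fin using (Fin; toℕ; fromℕ<; fromℕ; inject₁; _≟_)
open import Data.Fin.Properties using (toℕ<n; toℕ-fromℕ<; toℕ-fromℕ; toℕ-inject₁; toℕ-injective; pigeonhole; any?)
open import Data.Maybe using (just; nothing)
open import Data.Nat as ℕ using (ℕ; zero; suc; _≤_; _<_; _+_; z≤n; s≤s; s≤s⁻¹)
open import Data.Nat.Induction using (<-rec)
open import Data.Nat.Properties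
  using (suc-injective; <-irrefl; <-trans; ≤-trans; ≤-antisym; ≮⇒≥; <⇒≱; ≤∧≢⇒<; <-cmp; n<1+n;
         m<n⇒m<1+n; m≤n⇒m<n∨m≡n; +-cancelˡ-≡; m≤m+n; anyUpTo?; _<?_)
open import Data.Product using (Σ; ∃; ∃₂; ∃-syntax; _×_; _,_; proj₁; proj₂)
open import Data.Sum as Sum using (_⊎_; inj₁; inj₂; [_,_])
open import Data.Unit using (tt)
open import Data.Vec.Functional using (_∷_)
open import Function using (_∘_; id)
open import Function.Bundles using (_⇔_; mk⇔; Equivalence; _↔_; mk↔ₛ′; Inverse; _⤖_; Bijection)
open import Function.Construct.Composition using (_⇔-∘_)
open import Function.Properties.Bijection using (⤖⇒↔)
open import Function.Properties.Inverse using (↔⇒⤖)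
open import Relation.Binary.Definitions using (tri<; tri≈; tri>)
open import Relation.Binary.PropositionalEquality using (_≡_; _≢_; refl; sym; trans; cong; subst; subst₂)
open import Relation.Nullary using (¬_; Dec; yes; no; does)
open import Relation.Nullary.Decidable using (T?; _×-dec_; isYes; fromWitness; toWitness)
open import Relation.Unary using (Decidable)

InS-≡ : ∀ {G S} {p q : InS G S} → proj₁ p ≡ proj₁ q → p ≡ q
InS-≡ {p = v , s} {q = .v , s′} refl = cong (v ,_) (T-irrelevant s s′)

pair-cover : ∀ {A : Set} {a b c u v : A} → a ≢ b →
             a ≡ u ⊎ a ≡ v → b ≡ u ⊎ b ≡ v → c ≡ u ⊎ c ≡ v → c ≡ a ⊎ c ≡ b
pair-cover a≢b (inj₁ refl) (inj₁ refl) _ = ⊥-elim (a≢b refl)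
pair-cover _   (inj₁ refl) (inj₂ refl) c = c
pair-cover _   (inj₂ refl) (inj₁ refl) c = Sum.swap c
pair-cover a≢b (inj₂ refl) (inj₂ refl) _ = ⊥-elim (a≢b refl)

MinimalWitness : (ℕ → Set) → Set
MinimalWitness Q = ∃[ m ] (Q m × (∀ {i} → i < m → ¬ Q i))

minimalWitness : ∀ {Q} → Decidable Q → ∀ {j} → Q j → MinimalWitness Q
minimalWitness {Q} Q? {j} = <-rec (λ j → Q j → MinimalWitness Q) search j
  where
  search : ∀ j → (∀ {i} → i < j → Q i → MinimalWitness Q) → Q j → MinimalWitness Q
  search j below q with anyUpTo? Q? j
  ... | yes (i , i<j , qi) = below i<j qi
  ... | no none = j , q , λ i<j qi → none (_ , i<j , qi)

-- CycStep m a b unfolds to CycSucc m (toℕ a) (toℕ b).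
CycSucc : ℕ → ℕ → ℕ → Set
CycSucc m a b = suc a ≡ b ⊎ (suc a ≡ m × b ≡ 0)

cycSucc-functional : ∀ {m a b c} → b < m → c < m → CycSucc m a b → CycSucc m a c → b ≡ c
cycSucc-functional _   _   (inj₁ a→b)         (inj₁ a→c)         = trans (sym a→b) a→c
cycSucc-functional b<m _   (inj₁ refl)        (inj₂ (refl , _))  = ⊥-elim (<-irrefl refl b<m)
cycSucc-functional _   c<m (inj₂ (refl , _))  (inj₁ refl)        = ⊥-elim (<-irrefl refl c<m)
cycSucc-functional _   _   (inj₂ (_ , b≡0))   (inj₂ (_ , c≡0))   = trans b≡0 (sym c≡0)

cycSucc-injective : ∀ {m a b c} → CycSucc m a c → CycSucc m b c → a ≡ b
cycSucc-injective (inj₁ a→c)         (inj₁ b→c)         = suc-injective (trans a→c (sym b→c))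
cycSucc-injective (inj₁ refl)        (inj₂ (_ , ()))
cycSucc-injective (inj₂ (_ , ()))    (inj₁ refl)
cycSucc-injective (inj₂ (a→m , _))   (inj₂ (b→m , _))   = suc-injective (trans a→m (sym b→m))

cycSucc-asym : ∀ {m a b} → 3 ≤ m → CycSucc m a b → ¬ CycSucc m b a
cycSucc-asym {a = a} _ (inj₁ refl) (inj₁ 2+a≡a) = <-irrefl (sym 2+a≡a) (m<n⇒m<1+n (n<1+n a))
cycSucc-asym (s≤s (s≤s ())) (inj₁ refl)         (inj₂ (refl , refl))
cycSucc-asym (s≤s (s≤s ())) (inj₂ (refl , refl)) (inj₁ refl)

cycNext : ∀ {m} (a : Fin m) → ∃[ b ] CycStep m a b
cycNext {suc m} a with suc (toℕ a) <? suc m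
... | yes a+1<m = fromℕ< a+1<m , inj₁ (sym (toℕ-fromℕ< a+1<m))
... | no a+1≮m  = Fin.zero , inj₂ (≤-antisym (toℕ<n a) (≮⇒≥ a+1≮m) , refl)

cycPrev : ∀ {m} (a : Fin m) → ∃[ b ] CycStep m b a
cycPrev {suc m} Fin.zero    = fromℕ m , inj₂ (cong suc (toℕ-fromℕ m) , refl)
cycPrev {suc m} (Fin.suc a) = inject₁ a , inj₁ (cong suc (toℕ-inject₁ a))

cycPrev≢cycNext : ∀ {m} → 3 ≤ m → (a : Fin m) → proj₁ (cycPrev a) ≢ proj₁ (cycNext a)
cycPrev≢cycNext m≥3 a prev≡next =
  cycSucc-asym m≥3 (proj₂ (cycPrev a)) (subst (CycStep _ a) (sym prev≡next) (proj₂ (cycNext a)))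

cycAdj-cases : ∀ {m} {a b : Fin m} → CycAdj m a b → b ≡ proj₁ (cycNext a) ⊎ b ≡ proj₁ (cycPrev a)
cycAdj-cases {a = a} {b} (inj₁ a→b) =
  inj₁ (toℕ-injective (cycSucc-functional (toℕ<n b) (toℕ<n _) a→b (proj₂ (cycNext a))))
cycAdj-cases {a = a} (inj₂ b→a) = inj₂ (toℕ-injective (cycSucc-injective b→a (proj₂ (cycPrev a))))

CycVert : (k : ℕ) → (Fin k → ℕ) → Set
CycVert k ns = Σ (Fin k) (λ i → Fin (ns i))

bouquet-neighbours : ∀ {k ns i} (a : Fin (ns i)) y → BAdj k ns y (just (i , a)) →
  y ≡ just (i , proj₁ (cycNext a)) ⊎ y ≡ just (i , proj₁ (cycPrev a)) ⊎ y ≡ nothing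
bouquet-neighbours a nothing         _            = inj₂ (inj₂ refl)
bouquet-neighbours a (just (i , b)) (refl , b~a) =
  Sum.map (cong (λ c → just (i , c))) (inj₁ ∘ cong (λ c → just (i , c))) (cycAdj-cases (Sum.swap b~a))

BAdj-shift : ∀ {k m ns} {c c′ : CycVert k ns} →
  BAdj k ns (just c) (just c′) ⇔
  BAdj (suc k) (m ∷ ns) (just (Fin.suc (proj₁ c) , proj₂ c)) (just (Fin.suc (proj₁ c′) , proj₂ c′))
BAdj-shift = mk⇔ (λ { (refl , c~c′) → refl , c~c′ }) (λ { (refl , c~c′) → refl , c~c′ })

InducedBouquet : (G : Graph) → (V G → Bool) → (k : ℕ) → (Fin k → ℕ) → Set
InducedBouquet G S k ns =
  Σ (InS G S ⤖ BVert k ns) λ f →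
    ∀ p q → E G (proj₁ p) (proj₁ q) ⇔ BAdj k ns (Bijection.to f p) (Bijection.to f q)

Free : (G : Graph) → (V G → Bool) → Set
Free G S = ∀ u v → T (S u) → ¬ T (S v) → ¬ E G u v

free-step : ∀ G {S u v} → Free G S → T (S u) → E G u v → T (S v)
free-step G {S} {u} {v} free su u-v with T? (S v)
... | yes sv = sv
... | no ¬sv = ⊥-elim (free u v su ¬sv u-v)

free-dist≤2 : ∀ G {S u v} → Free G S → T (S u) → Dist≤2 G u v → T (S v)
free-dist≤2 G free su (inj₁ refl)                = su
free-dist≤2 G free su (inj₂ (inj₁ u-v))          = free-step G free su u-v
free-dist≤2 G free su (inj₂ (inj₂ (_ , u-w , w-v))) = free-step G free (free-step G free su u-w) w-v

module ApexOfFreeBouquet (G : Graph) {k} {ns : Fin k → ℕ} (ns≥3 : ∀ i → 3 ≤ ns i)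
  {S : V G → Bool} (f : InS G S ⤖ BVert k ns)
  (f-adj : ∀ p q → E G (proj₁ p) (proj₁ q) ⇔ BAdj k ns (Bijection.to f p) (Bijection.to f q))
  (free : Free G S) where

  open Inverse (⤖⇒↔ f) using (to; from; strictlyInverseˡ; strictlyInverseʳ)

  vertex : BVert k ns → V G
  vertex y = proj₁ (from y)

  apex : V G
  apex = vertex nothing

  vertex-≡ : ∀ {p y} → to p ≡ y → proj₁ p ≡ vertex y
  vertex-≡ {p} refl = sym (cong proj₁ (strictlyInverseʳ p))

  vertex-injective : ∀ {y y′} → vertex y ≡ vertex y′ → y ≡ y′
  vertex-injective {y} {y′} e =
    trans (sym (strictlyInverseˡ y)) (trans (cong to (InS-≡ {G} e)) (strictlyInverseˡ y′))

  vertex-adj : ∀ y y′ → BAdj k ns y y′ → E G (vertex y) (vertex y′)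
  vertex-adj y y′ y~y′ = Equivalence.from (f-adj (from y) (from y′))
    (subst₂ (BAdj k ns) (sym (strictlyInverseˡ y)) (sym (strictlyInverseˡ y′)) y~y′)

  cycle-vertex-ψ : ∀ z (s : T (S z)) i a → to (z , s) ≡ just (i , a) → E G apex z × ψ G apex z
  cycle-vertex-ψ z s i a z↦ia = apex-z , u , v , u≢v , u≢apex , v≢apex , z-u , z-v , only
    where
    a⁺ a⁻ : Fin (ns i)
    a⁺ = proj₁ (cycNext a)
    a⁻ = proj₁ (cycPrev a)

    u v : V G
    u = vertex (just (i , a⁺))
    v = vertex (just (i , a⁻))

    z≡ : z ≡ vertex (just (i , a))
    z≡ = vertex-≡ z↦ia

    apex-z : E G apex z
    apex-z = subst (E G apex) (sym z≡) (vertex-adj nothing (just (i , a)) tt)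

    z-u : E G z u
    z-u = subst (λ t → E G t u) (sym z≡)
            (vertex-adj (just (i , a)) (just (i , a⁺)) (refl , inj₁ (proj₂ (cycNext a))))

    z-v : E G z v
    z-v = subst (λ t → E G t v) (sym z≡)
            (vertex-adj (just (i , a)) (just (i , a⁻)) (refl , inj₂ (proj₂ (cycPrev a))))

    u≢v : u ≢ v
    u≢v u≡v = cycPrev≢cycNext (ns≥3 i) a
      (toℕ-injective (cong (λ { (just (_ , c)) → toℕ c ; nothing → 0 }) (sym (vertex-injective u≡v))))

    u≢apex : u ≢ apex
    u≢apex u≡apex with vertex-injective u≡apex
    ... | ()

    v≢apex : v ≢ apex
    v≢apex v≡apex with vertex-injective v≡apex
    ... | ()

    only : ∀ w → E G w z → w ≡ u ⊎ w ≡ v ⊎ w ≡ apex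
    only w w-z = Sum.map vertex-≡ (Sum.map vertex-≡ vertex-≡) (bouquet-neighbours a (to (w , sw)) w~z)
      where
      sw : T (S w)
      sw = free-step G free s (Graph.sym G w z w-z)
      w~z : BAdj k ns (to (w , sw)) (just (i , a))
      w~z = subst (BAdj k ns (to (w , sw))) z↦ia (Equivalence.to (f-adj (w , sw) (z , s)) w-z)

  apex-S : T (S apex)
  apex-S = proj₂ (from nothing)

  apex-ψ : ∀ z → z ≢ apex → Dist≤2 G apex z → E G apex z × ψ G apex z
  apex-ψ z z≢apex d with to (z , free-dist≤2 G free apex-S d) in z↦
  ... | nothing     = ⊥-elim (z≢apex (vertex-≡ z↦))
  ... | just (i , a) = cycle-vertex-ψ z _ i a z↦

  phi : Fin k → Phi G
  phi i = apex , vertex (just (i , a₀)) , vertex-adj nothing (just (i , a₀)) tt , apex-ψ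
    where
    a₀ : Fin (ns i)
    a₀ = fromℕ< (≤-trans (s≤s z≤n) (ns≥3 i))

freeBouquet⇒Phi : ∀ G → HasFreeBouquet G → Phi G
freeBouquet⇒Phi G (suc k , _ , ns , ns≥3 , S , f , f-adj , free) =
  ApexOfFreeBouquet.phi G ns≥3 f f-adj free Fin.zero

NeighbourIn : (G : Graph) → (V G → Bool) → V G → V G → Set
NeighbourIn G P z c = T (P c) × E G z c

record NeighboursIn (G : Graph) (P : V G → Bool) (z u v : V G) : Set where
  field
    u≢v   : u ≢ v
    nbr-u : NeighbourIn G P z u
    nbr-v : NeighbourIn G P z v
    only  : ∀ {c} → NeighbourIn G P z c → c ≡ u ⊎ c ≡ v

neighboursIn-any : ∀ {G P z u v a b} → NeighboursIn G P z u v →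
  a ≢ b → NeighbourIn G P z a → NeighbourIn G P z b → NeighboursIn G P z a b
neighboursIn-any N a≢b nbr-a nbr-b = record
  { u≢v = a≢b ; nbr-u = nbr-a ; nbr-v = nbr-b
  ; only = λ nbr-c → pair-cover a≢b (only nbr-a) (only nbr-b) (only nbr-c) }
  where open NeighboursIn N

TwoRegular : (G : Graph) → (V G → Bool) → Set
TwoRegular G P = ∀ z → T (P z) → ∃₂ (NeighboursIn G P z)

record CycleDecomposition (G : Graph) (S : V G → Bool) : Set where
  field
    k    : ℕ
    ns   : Fin k → ℕ
    ns≥3 : ∀ i → 3 ≤ ns i
    iso  : InS G S ↔ CycVert k ns
  open Inverse iso public using (to; from; strictlyInverseˡ; strictlyInverseʳ)
  field
    iso-adj : ∀ p q → E G (proj₁ p) (proj₁ q) ⇔ BAdj k ns (just (to p)) (just (to q))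

empty-decomposition : ∀ {G S} → (∀ {v} → ¬ T (S v)) → CycleDecomposition G S
empty-decomposition empty = record
  { k = 0 ; ns = λ () ; ns≥3 = λ ()
  ; iso = mk↔ₛ′ (λ p → ⊥-elim (empty (proj₂ p))) (λ { (() , _) })
                (λ { (() , _) }) (λ p → ⊥-elim (empty (proj₂ p)))
  ; iso-adj = λ p _ → ⊥-elim (empty (proj₂ p)) }

module TwoRegularDecomposition (G : Graph) (P : V G → Bool) (regular : TwoRegular G P) where

  -- Junk value (z , z) outside P.
  nbrs : V G → V G × V G
  nbrs z with T? (P z)
  ... | yes pz = proj₁ (regular z pz) , proj₁ (proj₂ (regular z pz))
  ... | no _   = z , z

  nbrs-spec : ∀ {z} → T (P z) → NeighboursIn G P z (proj₁ (nbrs z)) (proj₂ (nbrs z))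
  nbrs-spec {z} pz with T? (P z)
  ... | yes pz′ = proj₂ (proj₂ (regular z pz′))
  ... | no ¬pz  = ⊥-elim (¬pz pz)

  other : V G → V G → V G
  other a b with a ≟ proj₁ (nbrs b)
  ... | yes _ = proj₂ (nbrs b)
  ... | no _  = proj₁ (nbrs b)

  other-spec : ∀ a {b} → T (P b) → other a b ≢ a × NeighbourIn G P b (other a b)
  other-spec a {b} pb with a ≟ proj₁ (nbrs b)
  ... | yes refl = (λ e → NeighboursIn.u≢v (nbrs-spec pb) (sym e)) , NeighboursIn.nbr-v (nbrs-spec pb)
  ... | no a≢u   = (λ e → a≢u (sym e)) , NeighboursIn.nbr-u (nbrs-spec pb)

  record Closed (S : V G → Bool) : Set where
    field
      ⊆P     : ∀ {v} → T (S v) → T (P v)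
      closed : ∀ {z c} → T (S z) → NeighbourIn G P z c → T (S c)

  record Cycle (S : V G → Bool) : Set where
    field
      len              : ℕ
      len≥3            : 3 ≤ len
      vertex           : Fin len → V G
      vertex-S         : ∀ a → T (S (vertex a))
      vertex-injective : ∀ {a b} → vertex a ≡ vertex b → a ≡ b
      vertex-adj       : ∀ a b → E G (vertex a) (vertex b) ⇔ CycAdj len a b
      closed           : ∀ a {c} → NeighbourIn G P (vertex a) c → ∃[ b ] vertex b ≡ c

    OnCycle : V G → Set
    OnCycle v = ∃[ a ] vertex a ≡ v

    onCycle? : ∀ v → Dec (OnCycle v)
    onCycle? v = any? (λ a → vertex a ≟ v)

  module Walk {S} (cl : Closed S) {v₀} (s₀ : T (S v₀)) where
    open Closed cl

    -- The non-backtracking walk from v₀: state i = (w i , w (1 + i)).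
    state : ℕ → V G × V G
    state zero    = v₀ , proj₁ (nbrs v₀)
    state (suc i) = proj₂ (state i) , other (proj₁ (state i)) (proj₂ (state i))

    w : ℕ → V G
    w i = proj₁ (state i)

    step : ∀ i → T (S (w i)) × NeighbourIn G P (w i) (w (suc i))
    step zero    = s₀ , NeighboursIn.nbr-u (nbrs-spec (⊆P s₀))
    step (suc i) = s′ , proj₂ (other-spec (w i) (⊆P s′))
      where
      s′ : T (S (w (suc i)))
      s′ = closed (proj₁ (step i)) (proj₂ (step i))

    w-S : ∀ i → T (S (w i))
    w-S i = proj₁ (step i)

    w-edge : ∀ i → E G (w i) (w (suc i))
    w-edge i = proj₂ (proj₂ (step i))

    w-no-backtrack : ∀ i → w (suc (suc i)) ≢ w i
    w-no-backtrack i = proj₁ (other-spec (w i) (⊆P (w-S (suc i))))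

    w-neighbours : ∀ i → NeighboursIn G P (w (suc i)) (w i) (w (suc (suc i)))
    w-neighbours i = neighboursIn-any (nbrs-spec (⊆P (w-S (suc i)))) (λ e → w-no-backtrack i (sym e))
      (⊆P (w-S i) , Graph.sym G _ _ (w-edge i)) (proj₂ (step (suc i)))

    Repeat : ℕ → Set
    Repeat j = ∃[ i ] (i < j × w i ≡ w j)

    NoEarlierRepeat : ℕ → Set
    NoEarlierRepeat m = ∀ {j} → j < m → ¬ Repeat j

    firstRepeat : MinimalWitness Repeat
    firstRepeat with pigeonhole (n<1+n (n G)) (w ∘ toℕ)
    ... | i , j , i<j , wi≡wj =
      minimalWitness (λ j → anyUpTo? (λ i → w i ≟ w j) j) (toℕ i , i<j , wi≡wj)

    w-injective : ∀ {m} → NoEarlierRepeat m → ∀ {a b} → a < m → b < m → w a ≡ w b → a ≡ b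
    w-injective fresh {a} {b} a<m b<m wa≡wb with <-cmp a b
    ... | tri< a<b _ _ = ⊥-elim (fresh b<m (a , a<b , wa≡wb))
    ... | tri≈ _ a≡b _ = a≡b
    ... | tri> _ _ b<a = ⊥-elim (fresh a<m (b , b<a , sym wa≡wb))

    -- The predecessor w j of a first repeat w (1 + j) = w (1 + i) is a neighbour of w (1 + i),
    -- hence w i or w (2 + i); both are impossible.
    repeat-at-start : ∀ {m} → NoEarlierRepeat m → ∀ {i} → i < m → w i ≡ w m → i ≡ 0
    repeat-at-start _ {zero} _ _ = refl
    repeat-at-start {suc j} fresh {suc i} i<m wi≡wm
      with NeighboursIn.only (w-neighbours i)
             (⊆P (w-S j) , subst (λ t → E G t (w j)) (sym wi≡wm) (Graph.sym G _ _ (w-edge j)))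
    ... | inj₁ wj≡wi with w-injective fresh (n<1+n j) (<-trans (n<1+n i) i<m) wj≡wi
    ...   | refl = ⊥-elim (<-irrefl refl i<m)
    repeat-at-start {suc j} fresh {suc i} i<m wi≡wm | inj₂ wj≡w2+i with m≤n⇒m<n∨m≡n i<m
    ...   | inj₂ refl = ⊥-elim (irrefl G _ (subst (E G (w (suc i))) (sym wj≡w2+i) (w-edge (suc i))))
    ...   | inj₁ 2+i<m with w-injective fresh (n<1+n j) 2+i<m wj≡w2+i
    ...     | refl = ⊥-elim (w-no-backtrack (suc i) (sym wi≡wm))

    return-length≥3 : ∀ {m} → 0 < m → w 0 ≡ w m → 3 ≤ m
    return-length≥3 {suc zero}          _ w0≡w1 =
      ⊥-elim (irrefl G _ (subst (E G (w 0)) (sym w0≡w1) (w-edge 0)))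
    return-length≥3 {suc (suc zero)}    _ w0≡w2 = ⊥-elim (w-no-backtrack 0 (sym w0≡w2))
    return-length≥3 {suc (suc (suc _))} _ _     = s≤s (s≤s (s≤s z≤n))

    module Return {m} (fresh : NoEarlierRepeat m) (0<m : 0 < m) (w-return : w m ≡ w 0) where

      m≥3 : 3 ≤ m
      m≥3 = return-length≥3 0<m (sym w-return)

      cv : Fin m → V G
      cv a = w (toℕ a)

      cv-injective : ∀ {a b} → cv a ≡ cv b → a ≡ b
      cv-injective {a} {b} e = toℕ-injective (w-injective fresh (toℕ<n a) (toℕ<n b) e)

      cv-step : ∀ {a b} → CycStep m a b → E G (cv a) (cv b)
      cv-step {a} (inj₁ a+1≡b) = subst (λ t → E G (cv a) (w t)) a+1≡b (w-edge (toℕ a))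
      cv-step {a} (inj₂ (a+1≡m , b≡0)) =
        subst (E G (cv a)) (trans (cong w a+1≡m) (trans w-return (cong w (sym b≡0)))) (w-edge (toℕ a))

      cv-neighbours : ∀ a → NeighboursIn G P (cv a) (cv (proj₁ (cycPrev a))) (cv (proj₁ (cycNext a)))
      cv-neighbours a = neighboursIn-any (nbrs-spec (⊆P (w-S (toℕ a))))
        (cycPrev≢cycNext m≥3 a ∘ cv-injective)
        (⊆P (w-S (toℕ (proj₁ (cycPrev a)))) , Graph.sym G _ _ (cv-step (proj₂ (cycPrev a))))
        (⊆P (w-S (toℕ (proj₁ (cycNext a)))) , cv-step (proj₂ (cycNext a)))

      cv-adj⇒cycAdj : ∀ a b → E G (cv a) (cv b) → CycAdj m a b
      cv-adj⇒cycAdj a b e with NeighboursIn.only (cv-neighbours a) (⊆P (w-S (toℕ b)) , e)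
      ... | inj₁ b≡prev with cv-injective {b} {proj₁ (cycPrev a)} b≡prev
      ...   | refl = inj₂ (proj₂ (cycPrev a))
      cv-adj⇒cycAdj a b e | inj₂ b≡next with cv-injective {b} {proj₁ (cycNext a)} b≡next
      ...   | refl = inj₁ (proj₂ (cycNext a))

      cycle : Cycle S
      cycle = record
        { len = m ; len≥3 = m≥3 ; vertex = cv ; vertex-S = w-S ∘ toℕ ; vertex-injective = cv-injective
        ; vertex-adj = λ a b → mk⇔ (cv-adj⇒cycAdj a b) [ cv-step , Graph.sym G _ _ ∘ cv-step ]
        ; closed = λ a nbr → [ (λ e → proj₁ (cycPrev a) , sym e) , (λ e → proj₁ (cycNext a) , sym e) ]
                               (NeighboursIn.only (cv-neighbours a) nbr)
        }

    cycleThrough : Σ (Cycle S) λ C → Cycle.OnCycle C v₀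
    cycleThrough with firstRepeat
    ... | m , (i , i<m , wi≡wm) , fresh with repeat-at-start fresh i<m wi≡wm
    ...   | refl = Return.cycle fresh i<m (sym wi≡wm) , fromℕ< i<m , cong w (toℕ-fromℕ< i<m)

  _∖_ : (S : V G → Bool) → Cycle S → V G → Bool
  (S ∖ C) v = S v ∧ not (does (Cycle.onCycle? C v))

  ∖-⊆ : ∀ {S} (C : Cycle S) {v} → T ((S ∖ C) v) → T (S v) × ¬ Cycle.OnCycle C v
  ∖-⊆ {S} C {v} t with Cycle.onCycle? C v | Equivalence.to (T-∧ {S v}) t
  ... | no off | s , _ = s , off

  ∖-∋ : ∀ {S} (C : Cycle S) {v} → T (S v) → ¬ Cycle.OnCycle C v → T ((S ∖ C) v)
  ∖-∋ C {v} s off with Cycle.onCycle? C v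
  ... | yes on = ⊥-elim (off on)
  ... | no _   = Equivalence.from T-∧ (s , tt)

  ∖-closed : ∀ {S} → Closed S → (C : Cycle S) → Closed (S ∖ C)
  ∖-closed cl C = record
    { ⊆P     = Closed.⊆P cl ∘ proj₁ ∘ ∖-⊆ C
    ; closed = λ t nbr → let (s , off) = ∖-⊆ C t in
        ∖-∋ C (Closed.closed cl s nbr)
          (λ { (a , refl) → off (Cycle.closed C a (Closed.⊆P cl s , Graph.sym G _ _ (proj₂ nbr))) })
    }

  extend : ∀ {S} → Closed S → (C : Cycle S) → CycleDecomposition G (S ∖ C) → CycleDecomposition G S
  extend {S} cl C D = record
    { k = suc k ; ns = len ∷ ns ; ns≥3 = λ { Fin.zero → len≥3 ; (Fin.suc i) → ns≥3 i }
    ; iso = mk↔ₛ′ to′ from′ to∘from′ from∘to′ ; iso-adj = adj′ }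
    where
    open Cycle C
    open CycleDecomposition D

    shift : CycVert k ns → CycVert (suc k) (len ∷ ns)
    shift (i , b) = Fin.suc i , b

    place : ∀ {v} → T (S v) → Dec (OnCycle v) → CycVert (suc k) (len ∷ ns)
    place     _ (yes (a , _)) = Fin.zero , a
    place {v} s (no off)      = shift (to (v , ∖-∋ C s off))

    place-off : ∀ {v} (s : T (S v)) (off : ¬ OnCycle v) on? → place s on? ≡ shift (to (v , ∖-∋ C s off))
    place-off s off (yes on) = ⊥-elim (off on)
    place-off s off (no _)   = cong (shift ∘ to) (InS-≡ {G} refl)

    to′ : InS G S → CycVert (suc k) (len ∷ ns)
    to′ (v , s) = place s (onCycle? v)

    from′ : CycVert (suc k) (len ∷ ns) → InS G S
    from′ (Fin.zero , a)  = vertex a , vertex-S a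
    from′ (Fin.suc i , b) = proj₁ (from (i , b)) , proj₁ (∖-⊆ C (proj₂ (from (i , b))))

    to∘from′ : ∀ c → to′ (from′ c) ≡ c
    to∘from′ (Fin.zero , a) with onCycle? (vertex a)
    ... | yes (a′ , a′↦a) = cong (Fin.zero ,_) (vertex-injective a′↦a)
    ... | no off          = ⊥-elim (off (a , refl))
    to∘from′ (Fin.suc i , b) =
      trans (place-off (proj₂ (from′ (Fin.suc i , b))) (proj₂ (∖-⊆ C (proj₂ (from (i , b))))) (onCycle? _))
            (cong shift (trans (cong to (InS-≡ {G} refl)) (strictlyInverseˡ (i , b))))

    from∘to′ : ∀ p → from′ (to′ p) ≡ p
    from∘to′ (v , s) with onCycle? v
    ... | yes (_ , a↦v) = InS-≡ {G} a↦v
    ... | no off        = InS-≡ {G} (cong proj₁ (strictlyInverseʳ (v , ∖-∋ C s off)))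

    adj′ : ∀ p q → E G (proj₁ p) (proj₁ q) ⇔ BAdj (suc k) (len ∷ ns) (just (to′ p)) (just (to′ q))
    adj′ (v , s) (v′ , s′) with onCycle? v | onCycle? v′
    ... | yes (a , refl) | yes (b , refl) =
      mk⇔ (λ e → refl , Equivalence.to (vertex-adj a b) e)
          (λ { (refl , a~b) → Equivalence.from (vertex-adj a b) a~b })
    ... | yes (a , refl) | no off′ =
      mk⇔ (λ e → ⊥-elim (off′ (closed a (Closed.⊆P cl s′ , e)))) (λ { (() , _) })
    ... | no off | yes (b , refl) =
      mk⇔ (λ e → ⊥-elim (off (closed b (Closed.⊆P cl s , Graph.sym G _ _ e)))) (λ { (() , _) })
    ... | no off | no off′ = BAdj-shift ⇔-∘ iso-adj (v , ∖-∋ C s off) (v′ , ∖-∋ C s′ off′)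

  -- S lies within the last d vertices; the cycle through the first of the last d + 1 vertices,
  -- if it belongs to S, is split off.
  decompose : ∀ d {S} → Closed S → (∀ {v} → T (S v) → n G ≤ d + toℕ v) → CycleDecomposition G S
  decompose zero cl bound = empty-decomposition (λ {v} s → <⇒≱ (toℕ<n v) (bound s))
  decompose (suc d) {S} cl bound with any? (λ v → T? (S v) ×-dec (n G ℕ.≟ suc (d + toℕ v)))
  ... | no none = decompose d cl (λ {v} s → s≤s⁻¹ (≤∧≢⇒< (bound s) (λ e → none (v , s , e))))
  ... | yes (v₀ , s₀ , e₀) = extend cl C (decompose d (∖-closed cl C) bound′)
    where
    open Walk cl s₀ using (cycleThrough)

    C : Cycle S
    C = proj₁ cycleThrough

    bound′ : ∀ {v} → T ((S ∖ C) v) → n G ≤ d + toℕ v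
    bound′ {v} t = s≤s⁻¹ (≤∧≢⇒< (bound s) v₀-excluded)
      where
      s : T (S v)
      s = proj₁ (∖-⊆ C t)
      v₀-excluded : n G ≢ suc (d + toℕ v)
      v₀-excluded e
        with toℕ-injective {i = v} {j = v₀} (+-cancelˡ-≡ d _ _ (suc-injective (trans (sym e) e₀)))
      ... | refl = proj₂ (∖-⊆ C t) (proj₂ cycleThrough)

  cycleDecomposition : CycleDecomposition G P
  cycleDecomposition =
    decompose (n G) {P} (record { ⊆P = id ; closed = λ _ → proj₁ }) (λ {v} _ → m≤m+n (n G) (toℕ v))

closedNbhd : (G : Graph) → V G → V G → Bool
closedNbhd G x v = isYes (v ≟ x) ∨ adj G x v

closedNbhd-apex : ∀ G x → T (closedNbhd G x x)
closedNbhd-apex G x = Equivalence.from (T-∨ {isYes (x ≟ x)}) (inj₁ (fromWitness refl))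

closedNbhd-nbr : ∀ G x {v} → E G x v → T (closedNbhd G x v)
closedNbhd-nbr G x {v} = Equivalence.from (T-∨ {isYes (v ≟ x)}) ∘ inj₂

closedNbhd-cases : ∀ G x {v} → T (closedNbhd G x v) → v ≡ x ⊎ E G x v
closedNbhd-cases G x {v} s = Sum.map₁ toWitness (Equivalence.to (T-∨ {isYes (v ≟ x)}) s)

module Cone (G : Graph) (x : V G) (D : CycleDecomposition G (adj G x)) where
  open CycleDecomposition D

  place : ∀ {v} (d : Dec (v ≡ x)) → T (isYes d ∨ adj G x v) → BVert k ns
  place     (yes _) _ = nothing
  place {v} (no _)  s = just (to (v , s))

  place-apex : ∀ d s → place {x} d s ≡ nothing
  place-apex (yes _)  _ = refl
  place-apex (no x≢x) _ = ⊥-elim (x≢x refl)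

  place-nbr : ∀ {v} d s (x-v : E G x v) → place {v} d s ≡ just (to (v , x-v))
  place-nbr (yes refl) _ x-x = ⊥-elim (irrefl G x x-x)
  place-nbr (no _)     _ _   = cong (just ∘ to) (InS-≡ {G} refl)

  to′ : InS G (closedNbhd G x) → BVert k ns
  to′ (v , s) = place (v ≟ x) s

  from′ : BVert k ns → InS G (closedNbhd G x)
  from′ nothing  = x , closedNbhd-apex G x
  from′ (just c) = proj₁ (from c) , closedNbhd-nbr G x (proj₂ (from c))

  from∘place : ∀ {v} d s → proj₁ (from′ (place {v} d s)) ≡ v
  from∘place (yes v≡x) _ = sym v≡x
  from∘place (no _)    s = cong proj₁ (strictlyInverseʳ (_ , s))

  place-adj : ∀ {v v′} d s d′ s′ → E G v v′ ⇔ BAdj k ns (place {v} d s) (place {v′} d′ s′)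
  place-adj (yes refl) _ (yes refl) _  = mk⇔ (irrefl G x) ⊥-elim
  place-adj (yes refl) _ (no _)     s′ = mk⇔ (λ _ → tt) (λ _ → s′)
  place-adj (no _)     s (yes refl) _  = mk⇔ (λ _ → tt) (λ _ → Graph.sym G _ _ s)
  place-adj (no _)     s (no _)     s′ = iso-adj (_ , s) (_ , s′)

  iso′ : InS G (closedNbhd G x) ↔ BVert k ns
  iso′ = mk↔ₛ′ to′ from′ to∘from′ (λ { (v , s) → InS-≡ {G} (from∘place (v ≟ x) s) })
    where
    to∘from′ : ∀ y → to′ (from′ y) ≡ y
    to∘from′ nothing  = place-apex (x ≟ x) _
    to∘from′ (just c) = trans (place-nbr _ _ (proj₂ (from c))) (cong just (strictlyInverseˡ c))

  cone : InducedBouquet G (closedNbhd G x) k ns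
  cone = ↔⇒⤖ iso′ , λ { (v , s) (v′ , s′) → place-adj (v ≟ x) s (v′ ≟ x) s′ }

module FromPhi (G : Graph) {x y : V G} (x-y : E G x y)
  (H : ∀ z → z ≢ x → Dist≤2 G x z → E G x z × ψ G x z) where

  nbr≢x : ∀ {z} → E G x z → z ≢ x
  nbr≢x x-z refl = irrefl G _ x-z

  nbhd-regular : TwoRegular G (adj G x)
  nbhd-regular z x-z with H z (nbr≢x x-z) (inj₂ (inj₁ x-z))
  ... | _ , u , v , u≢v , u≢x , v≢x , z-u , z-v , only = u , v , record
    { u≢v   = u≢v
    ; nbr-u = proj₁ (H u u≢x (inj₂ (inj₂ (z , x-z , z-u)))) , z-u
    ; nbr-v = proj₁ (H v v≢x (inj₂ (inj₂ (z , x-z , z-v)))) , z-v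
    ; only  = λ { (x-c , z-c) → Sum.map₂ [ id , (λ { refl → ⊥-elim (irrefl G x x-c) }) ]
                                           (only _ (Graph.sym G _ _ z-c)) }
    }

  closedNbhd-free : Free G (closedNbhd G x)
  closedNbhd-free u v su ¬sv u-v = ¬sv (closedNbhd-nbr G x (proj₁ (H v v≢x x⋯v)))
    where
    v≢x : v ≢ x
    v≢x refl = ¬sv (closedNbhd-apex G x)
    x⋯v : Dist≤2 G x v
    x⋯v = [ (λ { refl → inj₂ (inj₁ u-v) }) , (λ x-u → inj₂ (inj₂ (u , x-u , u-v))) ]
            (closedNbhd-cases G x su)

  hasFreeBouquet : HasFreeBouquet G
  hasFreeBouquet = k , k≥1 , ns , ns≥3 , closedNbhd G x , proj₁ cone , proj₂ cone , closedNbhd-free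
    where
    D : CycleDecomposition G (adj G x)
    D = TwoRegularDecomposition.cycleDecomposition G (adj G x) nbhd-regular
    open CycleDecomposition D using (k; ns; ns≥3; to)
    open Cone G x D using (cone)
    k≥1 : 1 ≤ k
    k≥1 = ≤-trans (s≤s z≤n) (toℕ<n (proj₁ (to (y , x-y))))

lemma3p3 : (G : Graph) → Phi G ⇔ HasFreeBouquet G
lemma3p3 G = mk⇔ (λ { (x , y , x-y , H) → FromPhi.hasFreeBouquet G x-y H }) (freeBouquet⇒Phi G)
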